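{- Let $\Phi\subseteq\{I,O,Q,U,\mathit{Self}\}$ and let $(\mathcal{R},\mathcal{T},\mathcal{A})$ be a knowledge base in $\mathcal{L}_\Phi$ such that $\mathcal{R}=\emptyset$ and either $O\in\Phi$ or $\mathcal{A}$ contains only assertions of the form $C(a)$. Let $\mathcal{I},\mathcal{I}'$ be unreachable-objects-free interpretations (w.r.t. $\mathcal{L}_\Phi$) such that there exists an $\mathcal{L}_\Phi$-bisimulation between them. Then $\mathcal{I}$ is a model of $(\mathcal{R},\mathcal{T},\mathcal{A})$ iff $\mathcal{I}'$ is a model of $(\mathcal{R},\mathcal{T},\mathcal{A})$.
   Context: Fix finite sets $\Sigma_C,\Sigma_R,\Sigma_I$ of concept, role and individual names. Roles/concepts of $\mathcal{L}_\Phi$: $r\in\Sigma_R$ roles, $A\in\Sigma_C$ concepts; closed under role constructors $\varepsilon, R\circ S, R\sqcup S, R^*, C?$ and concept constructors $\top,\bot,\neg C,C\sqcap D,C\sqcup D,\forall R.C,\exists R.C$; plus $R^-$ if $I\in\Phi$; $\{a\}$ if $O\in\Phi$; $\geq n\,r.C$, $\leq n\,r.C$ if $Q\in\Phi$, and $\geq n\,r^-.C$, $\leq n\,r^-.C$ if $Q,I\in\Phi$; role $U$ if $U\in\Phi$; $\exists r.\mathit{Self}$ if $\mathit{Self}\in\Phi$. Standard semantics: composition, union, reflexive-transitive closure, $(C?)^{\mathcal{I}}=\{(x,x):x\in C^{\mathcal{I}}\}$, $\varepsilon^{\mathcal{I}}$ identity, $U^{\mathcal{I}}=(\Delta^{\mathcal{I}})^2$,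 inverse, Booleans, $\{a\}^{\mathcal{I}}=\{a^{\mathcal{I}}\}$, $(\exists r.\mathit{Self})^{\mathcal{I}}=\{x:(x,x)\in r^{\mathcal{I}}\}$, $\forall,\exists$ as usual, $(\geq n\,R.C)^{\mathcal{I}}=\{x:\#\{y:(x,y)\in R^{\mathcal{I}},y\in C^{\mathcal{I}}\}\ge n\}$, similarly $\le n$. Basic roles: elements of $\Sigma_R\cup\{r^-:r\in\Sigma_R\}$ if $I\in\Phi$, of $\Sigma_R$ otherwise. RBox: finite set of role axioms $\varepsilon\sqsubseteq r$ or $R_1\circ\dots\circ R_k\sqsubseteq r$ ($R_i$ basic). TBox: finite set of $C\sqsubseteq D$, valid iff $C^{\mathcal{I}}\subseteq D^{\mathcal{I}}$. ABox: finite set of assertions $C(a)$, $R(a,b)$, $\neg R(a,b)$, $a=b$, $a\not\doteq b$ with the obvious satisfaction ($a^{\mathcal{I}}\in C^{\mathcal{I}}$, $(a^{\mathcal{I}},b^{\mathcal{I}})\in R^{\mathcal{I}}$, its negation, $a^{\mathcal{I}}=b^{\mathcal{I}}$, $a^{\mathcal{I}}\ne b^{\mathcal{I}}$). A model of a knowledge base $(\mathcal{R},\mathcal{T},\mathcal{A})$ is a model of all three. $\mathcal{I}$ is unreachable-objects-free if every element is reachable from some $a^{\mathcal{I}}$ ($a\in\Sigma_I$) by a finite path of edges in $R^{\mathcal{I}}$ for basic roles $R$. $Z\subseteq\Delta^{\mathcal{I}}\times\Delta^{\mathcal{I}'}$ is an $\mathcal{L}_\Phi$-bisimulation if for all $a,A,r$,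 $x,y\in\Delta^{\mathcal{I}}$, $x',y'\in\Delta^{\mathcal{I}'}$: (B1) $Z(a^{\mathcal{I}},a^{\mathcal{I}'})$; (B2) $Z(x,x')\Rightarrow(x\in A^{\mathcal{I}}\iff x'\in A^{\mathcal{I}'})$; (B3) $Z(x,x')\wedge(x,y)\in r^{\mathcal{I}}\Rightarrow\exists y'(Z(y,y')\wedge(x',y')\in r^{\mathcal{I}'})$; (B4) $Z(x,x')\wedge(x',y')\in r^{\mathcal{I}'}\Rightarrow\exists y(Z(y,y')\wedge(x,y)\in r^{\mathcal{I}})$; if $I\in\Phi$: (B5),(B6) analogous for predecessors; if $O\in\Phi$: (B7) $Z(x,x')\Rightarrow(x=a^{\mathcal{I}}\iff x'=a^{\mathcal{I}'})$; if $Q\in\Phi$: (B8) $Z(x,x')$ implies for every $r$ a bijection between $r$-successors of $x$ and of $x'$ contained in $Z$; if $Q,I\in\Phi$ also (B9) the same for $r$-predecessors; if $U\in\Phi$: (B10),(B11) $Z$ total on $\Delta^{\mathcal{I}}$ and surjective onto $\Delta^{\mathcal{I}'}$; if $\mathit{Self}\in\Phi$: (B12) $Z(x,x')\Rightarrow((x,x)\in r^{\mathcal{I}}\iff(x',x')\in r^{\mathcal{I}'})$. -}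

module Defs where

open import Data.Nat using (ℕ; suc)
open import Data.Fin using (Fin)
open import Data.Bool using (Bool; T)
open import Data.Product using (Σ; _×_; _,_; ∃; Σ-syntax; ∃-syntax)
open import Data.Sum using (_⊎_)
open import Data.Unit using (⊤)
open import Data.Empty using (⊥)
open import Data.List using (List; []; _∷_)
open import Data.List.NonEmpty using (List⁺; _∷_)
open import Data.List.Relation.Unary.All using (All)
open import Relation.Nullary using (¬_)
open import Relation.Binary.PropositionalEquality using (_≡_)
open import Relation.Binary.Construct.Closure.ReflexiveTransitive using (Star)
open import Function.Definitions using (Injective)

data Feature : Set where
  fI fO fQ fU fSelf : Feature

Features : Set
Features = Feature → Bool

-- Interpretation over the signature Σ_C = Fin nC, Σ_R = Fin nR, Σ_I = Fin nI.
record Interp (nC nR nI : ℕ) : Set₁ where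
  field
    Δ     : Set
    point : Δ                      -- the domain is non-empty
    conc  : Fin nC → Δ → Set
    role  : Fin nR → Δ → Δ → Set
    ind   : Fin nI → Δ
open Interp public

module _ (nC nR nI : ℕ) (Φ : Features) where

  data BasicRole : Set where
    bname : Fin nR → BasicRole
    binv  : T (Φ fI) → Fin nR → BasicRole

  mutual
    data Role : Set where
      rname : Fin nR → Role
      rε    : Role
      _∘ʳ_  : Role → Role → Role
      _⊔ʳ_  : Role → Role → Role
      _*ʳ   : Role → Role
      _?ʳ   : Concept → Role
      rinv  : T (Φ fI) → Role → Role
      rU    : T (Φ fU) → Role

    data Concept : Set where
      cname : Fin nC → Concept
      c⊤ c⊥ : Concept
      c¬    : Concept → Concept
      _⊓_   : Concept → Concept → Concept
      _⊔_   : Concept → Concept → Concept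
      c∀    : Role → Concept → Concept
      c∃    : Role → Concept → Concept
      cnom  : T (Φ fO) → Fin nI → Concept
      c≥    : T (Φ fQ) → ℕ → BasicRole → Concept → Concept
      c≤    : T (Φ fQ) → ℕ → BasicRole → Concept → Concept
      cSelf : T (Φ fSelf) → Fin nR → Concept

  data RoleAxiom : Set where
    εax   : Fin nR → RoleAxiom
    compAx : List⁺ BasicRole → Fin nR → RoleAxiom

  data Assertion : Set where
    conceptAss : Concept → Fin nI → Assertion
    roleAss    : Role → Fin nI → Fin nI → Assertion
    negRoleAss : Role → Fin nI → Fin nI → Assertion
    eqAss      : Fin nI → Fin nI → Assertion
    neqAss     : Fin nI → Fin nI → Assertion

  IsConceptAssertion : Assertion → Set
  IsConceptAssertion (conceptAss _ _) = ⊤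
  IsConceptAssertion _ = ⊥

  RBox TBox ABox : Set
  RBox = List RoleAxiom
  TBox = List (Concept × Concept)      -- (C , D) stands for C ⊑ D
  ABox = List Assertion

  record KB : Set where
    constructor kb
    field
      rbox : RBox
      tbox : TBox
      abox : ABox

  AtLeast : {D : Set} → ℕ → (D → Set) → Set
  AtLeast {D} n P = Σ[ f ∈ (Fin n → D) ] (Injective _≡_ _≡_ f × (∀ i → P (f i)))

  module Sem (𝓘 : Interp nC nR nI) where
    ⟦_⟧b : BasicRole → Δ 𝓘 → Δ 𝓘 → Set
    ⟦ bname r ⟧b x y = role 𝓘 r x y
    ⟦ binv _ r ⟧b x y = role 𝓘 r y x

    mutual
      ⟦_⟧r : Role → Δ 𝓘 → Δ 𝓘 → Set
      ⟦ rname r ⟧r x y = role 𝓘 r x y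
      ⟦ rε ⟧r x y = x ≡ y
      ⟦ R ∘ʳ S ⟧r x z = Σ[ y ∈ Δ 𝓘 ] (⟦ R ⟧r x y × ⟦ S ⟧r y z)
      ⟦ R ⊔ʳ S ⟧r x y = ⟦ R ⟧r x y ⊎ ⟦ S ⟧r x y
      ⟦ R *ʳ ⟧r x y = Star ⟦ R ⟧r x y
      ⟦ C ?ʳ ⟧r x y = x ≡ y × ⟦ C ⟧c x
      ⟦ rinv _ R ⟧r x y = ⟦ R ⟧r y x
      ⟦ rU _ ⟧r x y = ⊤

      ⟦_⟧c : Concept → Δ 𝓘 → Set
      ⟦ cname A ⟧c x = conc 𝓘 A x
      ⟦ c⊤ ⟧c x = ⊤
      ⟦ c⊥ ⟧c x = ⊥
      ⟦ c¬ C ⟧c x = ¬ ⟦ C ⟧c x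
      ⟦ C ⊓ D ⟧c x = ⟦ C ⟧c x × ⟦ D ⟧c x
      ⟦ C ⊔ D ⟧c x = ⟦ C ⟧c x ⊎ ⟦ D ⟧c x
      ⟦ c∀ R C ⟧c x = ∀ y → ⟦ R ⟧r x y → ⟦ C ⟧c y
      ⟦ c∃ R C ⟧c x = Σ[ y ∈ Δ 𝓘 ] (⟦ R ⟧r x y × ⟦ C ⟧c y)
      ⟦ cnom _ a ⟧c x = x ≡ ind 𝓘 a
      ⟦ c≥ _ n R C ⟧c x = AtLeast n (λ y → ⟦ R ⟧b x y × ⟦ C ⟧c y)
      ⟦ c≤ _ n R C ⟧c x = ¬ AtLeast (suc n) (λ y → ⟦ R ⟧b x y × ⟦ C ⟧c y)
      ⟦ cSelf _ r ⟧c x = role 𝓘 r x x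

    compList : List BasicRole → Δ 𝓘 → Δ 𝓘 → Set
    compList [] x y = x ≡ y
    compList (R ∷ Rs) x z = Σ[ y ∈ Δ 𝓘 ] (⟦ R ⟧b x y × compList Rs y z)

    satRA : RoleAxiom → Set
    satRA (εax r) = ∀ x → role 𝓘 r x x
    satRA (compAx (R ∷ Rs) r) = ∀ x y → compList (R ∷ Rs) x y → role 𝓘 r x y

    satGCI : Concept × Concept → Set
    satGCI (C , D) = ∀ x → ⟦ C ⟧c x → ⟦ D ⟧c x

    satAss : Assertion → Set
    satAss (conceptAss C a) = ⟦ C ⟧c (ind 𝓘 a)
    satAss (roleAss R a b) = ⟦ R ⟧r (ind 𝓘 a) (ind 𝓘 b)
    satAss (negRoleAss R a b) = ¬ ⟦ R ⟧r (ind 𝓘 a) (ind 𝓘 b)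
    satAss (eqAss a b) = ind 𝓘 a ≡ ind 𝓘 b
    satAss (neqAss a b) = ¬ (ind 𝓘 a ≡ ind 𝓘 b)

    basicEdge : Δ 𝓘 → Δ 𝓘 → Set
    basicEdge x y = Σ[ R ∈ BasicRole ] ⟦ R ⟧b x y

  IsModel : Interp nC nR nI → KB → Set
  IsModel 𝓘 K = All satRA (KB.rbox K) × All satGCI (KB.tbox K) × All satAss (KB.abox K)
    where open Sem 𝓘

  UnreachableObjectsFree : Interp nC nR nI → Set
  UnreachableObjectsFree 𝓘 = ∀ x → Σ[ a ∈ Fin nI ] Star basicEdge (ind 𝓘 a) x
    where open Sem 𝓘

  -- a bijection between {y | R x y} and {y' | R' x' y'} contained in Z
  record BijIn {D D' : Set} (R : D → D → Set) (R' : D' → D' → Set)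
               (Z : D → D' → Set) (x : D) (x' : D') : Set where
    field
      f    : (y : D) → R x y → D'
      g    : (y' : D') → R' x' y' → D
      f∈   : ∀ y (p : R x y) → R' x' (f y p)
      g∈   : ∀ y' (p : R' x' y') → R x (g y' p)
      fIrr : ∀ y (p q : R x y) → f y p ≡ f y q
      gIrr : ∀ y' (p q : R' x' y') → g y' p ≡ g y' q
      gf   : ∀ y (p : R x y) → g (f y p) (f∈ y p) ≡ y
      fg   : ∀ y' (p : R' x' y') → f (g y' p) (g∈ y' p) ≡ y'
      fZ   : ∀ y (p : R x y) → Z y (f y p)

  record IsBisimulation (𝓘 𝓘' : Interp nC nR nI) (Z : Δ 𝓘 → Δ 𝓘' → Set) : Set where
    field
      B1  : ∀ a → Z (ind 𝓘 a) (ind 𝓘' a)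
      B2  : ∀ A x x' → Z x x' → (conc 𝓘 A x → conc 𝓘' A x') × (conc 𝓘' A x' → conc 𝓘 A x)
      B3  : ∀ r x x' y → Z x x' → role 𝓘 r x y → Σ[ y' ∈ Δ 𝓘' ] (Z y y' × role 𝓘' r x' y')
      B4  : ∀ r x x' y' → Z x x' → role 𝓘' r x' y' → Σ[ y ∈ Δ 𝓘 ] (Z y y' × role 𝓘 r x y)
      B5  : T (Φ fI) → ∀ r x x' y → Z x x' → role 𝓘 r y x → Σ[ y' ∈ Δ 𝓘' ] (Z y y' × role 𝓘' r y' x')
      B6  : T (Φ fI) → ∀ r x x' y' → Z x x' → role 𝓘' r y' x' → Σ[ y ∈ Δ 𝓘 ] (Z y y' × role 𝓘 r y x)
      B7  : T (Φ fO) → ∀ a x x' → Z x x' → (x ≡ ind 𝓘 a → x' ≡ ind 𝓘' a) × (x' ≡ ind 𝓘' a → x ≡ ind 𝓘 a)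
      B8  : T (Φ fQ) → ∀ r x x' → Z x x' → BijIn (role 𝓘 r) (role 𝓘' r) Z x x'
      B9  : T (Φ fQ) → T (Φ fI) → ∀ r x x' → Z x x' →
            BijIn (λ u v → role 𝓘 r v u) (λ u v → role 𝓘' r v u) Z x x'
      B10 : T (Φ fU) → ∀ x → Σ[ x' ∈ Δ 𝓘' ] Z x x'
      B11 : T (Φ fU) → ∀ x' → Σ[ x ∈ Δ 𝓘 ] Z x x'
      B12 : T (Φ fSelf) → ∀ r x x' → Z x x' → (role 𝓘 r x x → role 𝓘' r x' x') × (role 𝓘' r x' x' → role 𝓘 r x x)

module Submission where

-- The heart of the argument is that a bisimulation Z transports the
-- extension of every concept: if Z x x' and x ∈ C then x' ∈ C.  The
-- back-and-forth conditions are phrased through one notion, a forth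
-- simulation 'Forth Z A A'' (every A-step from x is matched by an A'-step from
-- any Z-partner of x).  Forth simulations are closed under composition, union
-- and reflexive-transitive closure (also read backwards), and the converse of
-- a bisimulation is again a bisimulation.  Then one mutual induction over roles and concepts gives the
-- forth direction only; every backward step is the forth step for the
-- converse bisimulation.  Number restrictions are transported along the
-- bijections (B8)/(B9), which preserve "at least n".
--
-- For the knowledge base: the RBox is empty; a GCI C ⊑ D transfers because
-- every element of an unreachable-objects-free interpretation has a Z-partner
-- (lift the path from a named individual along Z); a concept assertion
-- transfers by (B1); with nominals, (B7) pins the partner of a named
-- individual, so role, equality and inequality assertions transfer too.

open import Defs
open import Data.Nat using (ℕ)
open import Data.Bool using (T)
open import Data.Fin using (Fin)
open import Data.Product using (Σ-syntax; _,_; proj₁; proj₂; _×_)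
open import Data.Sum using (_⊎_; inj₁; inj₂)
open import Data.Unit using (tt)
open import Data.List using ([])
open import Data.List.Relation.Unary.All using (All; [])
import Data.List.Relation.Unary.All as All
open import Relation.Binary.PropositionalEquality using (_≡_; refl; sym; trans; subst)
open import Relation.Binary.Construct.Closure.ReflexiveTransitive using (Star; ε; _◅_; reverse)
open import Relation.Binary.Construct.Union using (_∪_)
open import Function using (flip; id)
open import Function.Bundles using (_⇔_; mk⇔)
open import Function.Definitions using (Injective)

_⨾_ : {D : Set} → (D → D → Set) → (D → D → Set) → D → D → Set
_⨾_ {D} A B x z = Σ[ y ∈ D ] (A x y × B y z)

converse-comp : {D : Set} {A B : D → D → Set} {x z : D} → (A ⨾ B) x z → (flip B ⨾ flip A) z x
converse-comp (y , p , q) = y , q , p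

module _ {D D' : Set} (Z : D → D' → Set) where

  Forth : (D → D → Set) → (D' → D' → Set) → Set
  Forth A A' = ∀ {x x' y} → Z x x' → A x y → Σ[ y' ∈ D' ] (Z y y' × A' x' y')

  module _ {A B : D → D → Set} {A' B' : D' → D' → Set} where

    forth-map : (∀ {x y} → B x y → A x y) → (∀ {x y} → A' x y → B' x y) →
                Forth A A' → Forth B B'
    forth-map in-A in-B' fw z p with fw z (in-A p)
    ... | y' , zy , p' = y' , zy , in-B' p'

    forth-comp : Forth A A' → Forth B B' → Forth (A ⨾ B) (A' ⨾ B')
    forth-comp fwA fwB z (y , p , q) with fwA z p
    ... | y' , zy , p' with fwB zy q
    ... | w' , zw , q' = w' , zw , (y' , p' , q')

    forth-union : Forth A A' → Forth B B' → Forth (A ∪ B) (A' ∪ B')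
    forth-union fwA fwB z (inj₁ p) with fwA z p
    ... | y' , zy , p' = y' , zy , inj₁ p'
    forth-union fwA fwB z (inj₂ q) with fwB z q
    ... | y' , zy , q' = y' , zy , inj₂ q'

  module _ {A : D → D → Set} {A' : D' → D' → Set} where

    forth-star : Forth A A' → Forth (Star A) (Star A')
    forth-star fw z ε = _ , z , ε
    forth-star fw z (p ◅ ps) with fw z p
    ... | y' , zy , p' with forth-star fw zy ps
    ... | w' , zw , ps' = w' , zw , (p' ◅ ps')

  module _ {A : D → D → Set} {A' : D' → D' → Set} where

    forth-star-converse : Forth (flip A) (flip A') → Forth (flip (Star A)) (flip (Star A'))
    forth-star-converse fw =
      forth-map (reverse {T = A} id) (reverse {T = flip A'} id) (forth-star fw)

module _ {nC nR nI : ℕ} {Φ : Features} where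

  roleExt : (𝓘 : Interp nC nR nI) → Role nC nR nI Φ → Δ 𝓘 → Δ 𝓘 → Set
  roleExt 𝓘 = Sem.⟦_⟧r nC nR nI Φ 𝓘

  conceptExt : (𝓘 : Interp nC nR nI) → Concept nC nR nI Φ → Δ 𝓘 → Set
  conceptExt 𝓘 = Sem.⟦_⟧c nC nR nI Φ 𝓘

  basicExt : (𝓘 : Interp nC nR nI) → BasicRole nC nR nI Φ → Δ 𝓘 → Δ 𝓘 → Set
  basicExt 𝓘 = Sem.⟦_⟧b nC nR nI Φ 𝓘

  Bisimulation : (𝓘 𝓘' : Interp nC nR nI) → (Δ 𝓘 → Δ 𝓘' → Set) → Set
  Bisimulation = IsBisimulation nC nR nI Φ

  converseBij : {D D' : Set} {R : D → D → Set} {R' : D' → D' → Set} {Z : D → D' → Set} {x : D} {x' : D'} →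
    BijIn nC nR nI Φ R R' Z x x' → BijIn nC nR nI Φ R' R (flip Z) x' x
  converseBij {Z = Z} b = record
    { f = g ; g = f ; f∈ = g∈ ; g∈ = f∈ ; fIrr = gIrr ; gIrr = fIrr ; gf = fg ; fg = gf
    ; fZ = λ y' p → subst (Z (g y' p)) (fg y' p) (fZ (g y' p) (g∈ y' p)) }
    where open BijIn b

  atLeast-transfer : {D D' : Set} {R : D → D → Set} {R' : D' → D' → Set} {Z : D → D' → Set} {x : D} {x' : D'} →
    BijIn nC nR nI Φ R R' Z x x' → {P : D → Set} {P' : D' → Set} →
    (∀ {y y'} → Z y y' → P y → P' y') → ∀ {n} →
    AtLeast nC nR nI Φ n (λ y → R x y × P y) → AtLeast nC nR nI Φ n (λ y' → R' x' y' × P' y')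
  atLeast-transfer {D' = D'} {R' = R'} {x' = x'} b {P' = P'} transport {n} (h , h-inj , h∈) =
    image , image-inj , image∈
    where
      open BijIn b
      image : Fin n → D'
      image i = f (h i) (proj₁ (h∈ i))
      -- g is a left inverse of f, hence f is injective
      g-cong : ∀ {y₁ y₂} (e : y₁ ≡ y₂) p₁ p₂ → g y₁ p₁ ≡ g y₂ p₂
      g-cong refl = gIrr _
      image-inj : Injective _≡_ _≡_ image
      image-inj {i} {j} e = h-inj (trans (sym (gf (h i) (proj₁ (h∈ i))))
                                  (trans (g-cong e _ _) (gf (h j) (proj₁ (h∈ j)))))
      image∈ : ∀ i → R' x' (image i) × P' (image i)
      image∈ i = f∈ (h i) (proj₁ (h∈ i)) , transport (fZ (h i) (proj₁ (h∈ i))) (proj₂ (h∈ i))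

  converseBisim : ∀ {𝓘 𝓘' Z} → Bisimulation 𝓘 𝓘' Z → Bisimulation 𝓘' 𝓘 (flip Z)
  converseBisim B = record
    { B1 = B1
    ; B2 = λ A x x' z → swap (B2 A x' x z)
    ; B3 = λ r x x' → B4 r x' x ; B4 = λ r x x' → B3 r x' x
    ; B5 = λ i r x x' → B6 i r x' x ; B6 = λ i r x x' → B5 i r x' x
    ; B7 = λ o a x x' z → swap (B7 o a x' x z)
    ; B8 = λ q r x x' z → converseBij (B8 q r x' x z)
    ; B9 = λ q i r x x' z → converseBij (B9 q i r x' x z)
    ; B10 = B11 ; B11 = B10
    ; B12 = λ s r x x' z → swap (B12 s r x' x z) }
    where
      open IsBisimulation B
      swap : ∀ {P Q : Set} → (P → Q) × (Q → P) → (Q → P) × (P → Q)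
      swap (to , from) = from , to

  module _ {𝓘 𝓘' : Interp nC nR nI} {Z : Δ 𝓘 → Δ 𝓘' → Set} (B : Bisimulation 𝓘 𝓘' Z) where
    open IsBisimulation B

    basicForth : ∀ R → Forth Z (basicExt 𝓘 R) (basicExt 𝓘' R)
    basicForth (bname r) z p = B3 r _ _ _ z p
    basicForth (binv i r) z p = B5 i r _ _ _ z p

    basicBij : T (Φ fQ) → ∀ R {x x'} → Z x x' → BijIn nC nR nI Φ (basicExt 𝓘 R) (basicExt 𝓘' R) Z x x'
    basicBij q (bname r) = B8 q r _ _
    basicBij q (binv i r) = B9 q i r _ _

    edgeForth : Forth Z (Sem.basicEdge nC nR nI Φ 𝓘) (Sem.basicEdge nC nR nI Φ 𝓘')
    edgeForth z (R , p) with basicForth R z p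
    ... | y' , zy , p' = y' , zy , (R , p')

  mutual
    roleForth : ∀ {𝓘 𝓘' Z} → Bisimulation 𝓘 𝓘' Z → ∀ R → Forth Z (roleExt 𝓘 R) (roleExt 𝓘' R)
    roleForth B (rname r) = basicForth B (bname r)
    roleForth B rε z refl = _ , z , refl
    roleForth {Z = Z} B (R ∘ʳ S) = forth-comp Z (roleForth B R) (roleForth B S)
    roleForth {Z = Z} B (R ⊔ʳ S) = forth-union Z (roleForth B R) (roleForth B S)
    roleForth {Z = Z} B (R *ʳ) = forth-star Z (roleForth B R)
    roleForth B (C ?ʳ) z (refl , c) = _ , z , refl , conceptForth B C z c
    roleForth B (rinv i R) = roleForth⁻ B i R
    roleForth B (rU u) {y = y} z tt with IsBisimulation.B10 B u y
    ... | y' , zy = y' , zy , tt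

    roleForth⁻ : ∀ {𝓘 𝓘' Z} → Bisimulation 𝓘 𝓘' Z → T (Φ fI) → ∀ R →
                 Forth Z (flip (roleExt 𝓘 R)) (flip (roleExt 𝓘' R))
    roleForth⁻ B i (rname r) = basicForth B (binv i r)
    roleForth⁻ B i rε z refl = _ , z , refl
    roleForth⁻ {𝓘} {𝓘'} {Z} B i (R ∘ʳ S) =
      forth-map Z (converse-comp {A = roleExt 𝓘 R} {roleExt 𝓘 S})
                  (converse-comp {A = flip (roleExt 𝓘' S)} {flip (roleExt 𝓘' R)})
                  (forth-comp Z (roleForth⁻ B i S) (roleForth⁻ B i R))
    roleForth⁻ {Z = Z} B i (R ⊔ʳ S) = forth-union Z (roleForth⁻ B i R) (roleForth⁻ B i S)
    roleForth⁻ {Z = Z} B i (R *ʳ) = forth-star-converse Z (roleForth⁻ B i R)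
    roleForth⁻ B i (C ?ʳ) z (refl , c) = _ , z , refl , conceptForth B C z c
    roleForth⁻ B i (rinv _ R) = roleForth B R
    roleForth⁻ B i (rU u) {y = y} z tt with IsBisimulation.B10 B u y
    ... | y' , zy = y' , zy , tt

    conceptForth : ∀ {𝓘 𝓘' Z} → Bisimulation 𝓘 𝓘' Z → ∀ C {x x'} → Z x x' →
                   conceptExt 𝓘 C x → conceptExt 𝓘' C x'
    conceptForth B (cname A) z = proj₁ (IsBisimulation.B2 B A _ _ z)
    conceptForth B c⊤ z _ = tt
    conceptForth B c⊥ z ()
    conceptForth B (c¬ C) z ¬c c' = ¬c (conceptForth (converseBisim B) C z c')
    conceptForth B (C ⊓ D) z (c , d) = conceptForth B C z c , conceptForth B D z d
    conceptForth B (C ⊔ D) z (inj₁ c) = inj₁ (conceptForth B C z c)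
    conceptForth B (C ⊔ D) z (inj₂ d) = inj₂ (conceptForth B D z d)
    conceptForth B (c∀ R C) z all y' p' with roleForth (converseBisim B) R z p'
    ... | y , zy , p = conceptForth B C zy (all y p)
    conceptForth B (c∃ R C) z (y , p , c) with roleForth B R z p
    ... | y' , zy , p' = y' , p' , conceptForth B C zy c
    conceptForth B (cnom o a) z = proj₁ (IsBisimulation.B7 B o a _ _ z)
    conceptForth B (c≥ q n R C) z =
      atLeast-transfer (basicBij B q R z) (conceptForth B C)
    conceptForth B (c≤ q n R C) z atMost many' =
      atMost (atLeast-transfer (basicBij (converseBisim B) q R z) (conceptForth (converseBisim B) C) many')
    conceptForth B (cSelf s r) z = proj₁ (IsBisimulation.B12 B s r _ _ z)

  module _ {𝓘 𝓘' : Interp nC nR nI} {Z : Δ 𝓘 → Δ 𝓘' → Set} (B : Bisimulation 𝓘 𝓘' Z) where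
    open IsBisimulation B

    -- With nominals, (B7) forces the partner of b^𝓘 to be b^𝓘', so role
    -- assertions transfer.  (Stated apart: it is also used for the converse.)
    roleAssertionForth : T (Φ fO) → ∀ R a b →
      roleExt 𝓘 R (ind 𝓘 a) (ind 𝓘 b) → roleExt 𝓘' R (ind 𝓘' a) (ind 𝓘' b)
    roleAssertionForth o R a b p with roleForth B R (B1 a) p
    ... | y' , zy , p' = subst (roleExt 𝓘' R (ind 𝓘' a)) (proj₁ (B7 o b _ y' zy) refl) p'

  module _ {𝓘 𝓘' : Interp nC nR nI} {Z : Δ 𝓘 → Δ 𝓘' → Set} (B : Bisimulation 𝓘 𝓘' Z) where
    open IsBisimulation B

    -- In an unreachable-objects-free 𝓘' every element has a Z-partner: lift
    -- the path from a named individual backwards along Z, starting from (B1).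
    partner : UnreachableObjectsFree nC nR nI Φ 𝓘' → ∀ x' → Σ[ x ∈ Δ 𝓘 ] Z x x'
    partner uof' x' with uof' x'
    ... | a , path with forth-star (flip Z) (edgeForth (converseBisim B)) (B1 a) path
    ...   | x , zx , _ = x , zx

    gciForth : UnreachableObjectsFree nC nR nI Φ 𝓘' → ∀ G →
               Sem.satGCI nC nR nI Φ 𝓘 G → Sem.satGCI nC nR nI Φ 𝓘' G
    gciForth uof' (C , D) C⊑D x' c' with partner uof' x'
    ... | x , z = conceptForth B D z (C⊑D x (conceptForth (converseBisim B) C z c'))

    assertionForth : ∀ α → T (Φ fO) ⊎ IsConceptAssertion nC nR nI Φ α →
      Sem.satAss nC nR nI Φ 𝓘 α → Sem.satAss nC nR nI Φ 𝓘' α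
    assertionForth (conceptAss C a) _ = conceptForth B C (B1 a)
    assertionForth (roleAss R a b) (inj₁ o) = roleAssertionForth B o R a b
    assertionForth (negRoleAss R a b) (inj₁ o) ¬p p' =
      ¬p (roleAssertionForth (converseBisim B) o R a b p')
    assertionForth (eqAss a b) (inj₁ o) = proj₁ (B7 o b _ _ (B1 a))
    assertionForth (neqAss a b) (inj₁ o) ≢ e' = ≢ (proj₂ (B7 o b _ _ (B1 a)) e')
    assertionForth (roleAss _ _ _) (inj₂ ())
    assertionForth (negRoleAss _ _ _) (inj₂ ())
    assertionForth (eqAss _ _) (inj₂ ())
    assertionForth (neqAss _ _) (inj₂ ())

    modelForth : (K : KB nC nR nI Φ) → KB.rbox K ≡ [] →
      T (Φ fO) ⊎ All (IsConceptAssertion nC nR nI Φ) (KB.abox K) →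
      UnreachableObjectsFree nC nR nI Φ 𝓘' →
      IsModel nC nR nI Φ 𝓘 K → IsModel nC nR nI Φ 𝓘' K
    modelForth (kb _ tb ab) refl aboxShape uof' (_ , tbox , abox) =
      [] , All.map (λ {G} → gciForth uof' G) tbox , aboxForth aboxShape
      where
        aboxForth : T (Φ fO) ⊎ All (IsConceptAssertion nC nR nI Φ) ab →
                    All (Sem.satAss nC nR nI Φ 𝓘') ab
        aboxForth (inj₁ o) = All.map (λ {α} → assertionForth α (inj₁ o)) abox
        aboxForth (inj₂ concepts) =
          All.zipWith (λ {α} (c , h) → assertionForth α (inj₂ c) h) (concepts , abox)

theorem5 : ∀ {nC nR nI : ℕ} (Φ : Features) (K : KB nC nR nI Φ) →
    KB.rbox K ≡ [] →
    (T (Φ fO) ⊎ All (IsConceptAssertion nC nR nI Φ) (KB.abox K)) →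
    (𝓘 𝓘' : Interp nC nR nI) →
    UnreachableObjectsFree nC nR nI Φ 𝓘 →
    UnreachableObjectsFree nC nR nI Φ 𝓘' →
    (Σ[ Z ∈ (Δ 𝓘 → Δ 𝓘' → Set) ] IsBisimulation nC nR nI Φ 𝓘 𝓘' Z) →
    (IsModel nC nR nI Φ 𝓘 K ⇔ IsModel nC nR nI Φ 𝓘' K)
theorem5 Φ K noRoleAxioms aboxShape 𝓘 𝓘' uof uof' (Z , B) =
  mk⇔ (modelForth B K noRoleAxioms aboxShape uof')
      (modelForth (converseBisim B) K noRoleAxioms aboxShape uof)
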